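{- For every $\ell\in\mathbb N$ and $s=2^\ell$, the augmented Beneš network satisfies $\gamma(\check B_\ell)\ge s/3$.
   Context: Plain Beneš networks $B_\ell$ with inputs $v_1,\dots,v_s$ and outputs $w_1,\dots,w_s$ ($s=2^\ell$) are defined recursively: $B_1$ is $K_{2,2}$ with inputs $v_1,v_2$ on one side and outputs $w_1,w_2$ on the other. For $\ell\ge2$, take two disjoint copies $B^{\uparrow},B^{\downarrow}$ of $B_{\ell-1}$ with inputs $v_i^{\uparrow},v_i^{\downarrow}$ and outputs $w_i^{\uparrow},w_i^{\downarrow}$ ($i\in[s/2]$), add new vertices $v_1,\dots,v_s,w_1,\dots,w_s$, and for each $i\in[s/2]$ add all four edges between $\{v_i,v_{i+s/2}\}$ and $\{v_i^{\uparrow},v_i^{\downarrow}\}$ and all four edges between $\{w_i,w_{i+s/2}\}$ and $\{w_i^{\uparrow},w_i^{\downarrow}\}$. $\check B_\ell$ is $B_\ell$ plus the edges $w_{2i-1}w_{2i}$, $i\in[s/2]$. The blowup $H\otimes J_t$ has vertices $v^{(i)}$ ($v\in V(H)$, $i\in[t]$) and edges $u^{(i)}v^{(j)}$ for $uv\in E(H)$, $i,j\in[t]$, and $u^{(i)}u^{(j)}$ for $u\in V(H)$, $i\ne j$. A set $X\subseteq V(H')$ is matching-linked if for every set $M$ of pairwise disjoint pairs of distinct elements of $X$ there are pairwise vertex-disjoint paths in $H'$ joining the pairs of $M$. The linkage capacity $\gamma(H)$ is the supremum of all $c>0$ such that for all sufficiently large $t$, $H\otimes J_t$ contains a matching-linked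 set of size $\lfloor ct\rfloor$. -}

module Defs where

open import Data.Nat using (ℕ; zero; suc; _+_; _*_; _^_)
open import Data.Fin using (Fin; toℕ)
open import Data.Product using (_×_; _,_; Σ; ∃-syntax)
open import Data.Sum using (_⊎_)
open import Data.List using (List; []; _∷_; concat; map)
open import Data.List.Relation.Binary.Pointwise using (Pointwise)
open import Data.List.Relation.Unary.All using (All)
open import Data.List.Membership.Propositional using (_∈_)
open import Data.List.Relation.Unary.Unique.Propositional using (Unique)
open import Relation.Binary.PropositionalEquality using (_≡_)
open import Relation.Nullary using (¬_)

record Graph : Set₁ where
  field
    V   : Set
    Adj : V → V → Set
open Graph public

-- Index convention: BV n is the vertex set of
-- B_ℓ with ℓ = suc n, so s = 2 ^ suc n.  Inputs v_1..v_s are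
-- `inp i`, outputs w_1..w_s are `out i` (0-indexed: v_{i+1} = inp i).
-- For ℓ ≥ 2, `up x` / `down x` are the vertices of the copies
-- B^↑ / B^↓ of B_{ℓ-1}.

data BV : ℕ → Set where
  inp  : ∀ {n} → Fin (2 ^ suc n) → BV n
  out  : ∀ {n} → Fin (2 ^ suc n) → BV n
  up   : ∀ {n} → BV n → BV (suc n)
  down : ∀ {n} → BV n → BV (suc n)

-- j (0-indexed, j < s) and k (0-indexed, k < s/2) are related iff
-- j = k or j = k + s/2, i.e. {v_{k+1}, v_{k+1+s/2}} with index k+1.
Half : ℕ → ℕ → ℕ → Set
Half h j k = (j ≡ k) ⊎ (j ≡ k + h)

-- Edges of B_ℓ, listed once (oriented from inputs towards outputs).
data BE : ∀ n → BV n → BV n → Set where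
  base     : (i j : Fin (2 ^ 1)) → BE zero (inp i) (out j)
  in-up    : ∀ {n} (j : Fin (2 ^ suc (suc n))) (k : Fin (2 ^ suc n)) →
             Half (2 ^ suc n) (toℕ j) (toℕ k) → BE (suc n) (inp j) (up (inp k))
  in-down  : ∀ {n} (j : Fin (2 ^ suc (suc n))) (k : Fin (2 ^ suc n)) →
             Half (2 ^ suc n) (toℕ j) (toℕ k) → BE (suc n) (inp j) (down (inp k))
  out-up   : ∀ {n} (j : Fin (2 ^ suc (suc n))) (k : Fin (2 ^ suc n)) →
             Half (2 ^ suc n) (toℕ j) (toℕ k) → BE (suc n) (up (out k)) (out j)
  out-down : ∀ {n} (j : Fin (2 ^ suc (suc n))) (k : Fin (2 ^ suc n)) →
             Half (2 ^ suc n) (toℕ j) (toℕ k) → BE (suc n) (down (out k)) (out j)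
  lift-up   : ∀ {n} {x y : BV n} → BE n x y → BE (suc n) (up x) (up y)
  lift-down : ∀ {n} {x y : BV n} → BE n x y → BE (suc n) (down x) (down y)

-- Extra edges of the augmented network: w_{2i-1} w_{2i}, i ∈ [s/2]
-- (0-indexed: out (2i) -- out (2i+1)), only at the top level.
data AugE (n : ℕ) : BV n → BV n → Set where
  aug : (j j' : Fin (2 ^ suc n)) (i : ℕ) →
        toℕ j ≡ 2 * i → toℕ j' ≡ suc (2 * i) → AugE n (out j) (out j')

BenesCheck : ℕ → Graph
BenesCheck n .V = BV n
BenesCheck n .Adj x y = BE n x y ⊎ BE n y x ⊎ AugE n x y ⊎ AugE n y x

Blowup : Graph → ℕ → Graph
Blowup H t .V = V H × Fin t
Blowup H t .Adj (u , i) (v , j) = Adj H u v ⊎ ((u ≡ v) × ¬ (i ≡ j))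

data Walk (G : Graph) : V G → V G → List (V G) → Set where
  here : ∀ {a} → Walk G a a (a ∷ [])
  step : ∀ {a b c vs} → Adj G a b → Walk G b c vs → Walk G a c (a ∷ vs)

IsPath : (G : Graph) → V G → V G → List (V G) → Set
IsPath G a b vs = Walk G a b vs × Unique vs

ends : {A : Set} → List (A × A) → List A
ends [] = []
ends ((a , b) ∷ M) = a ∷ b ∷ ends M

IsMatchingOn : (G : Graph) → List (V G) → List (V G × V G) → Set
IsMatchingOn G X M = All (_∈ X) (ends M) × Unique (ends M)

MatchingLinked : (G : Graph) → List (V G) → Set
MatchingLinked G X =
  (M : List (V G × V G)) → IsMatchingOn G X M →
  ∃[ ps ] (Pointwise (λ ab vs → IsPath G (Data.Product.proj₁ ab) (Data.Product.proj₂ ab) vs) M ps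
           × Unique (concat ps))
  where import Data.Product

HasMatchingLinkedSet : (G : Graph) → ℕ → Set
HasMatchingLinkedSet G k =
  ∃[ X ] (Unique X × Data.List.length X ≡ k × MatchingLinked G X)
  where import Data.List

-- Take ⌊t/3⌋ + 1 copies of every input of B_ℓ as terminals: s (⌊t/3⌋ + 1) > s t / 3 of them.
-- Two terminals at the same input are adjacent in the blowup.  Otherwise both are routed to
-- the middle vertex of a common address m ∈ {0,1}^ℓ, descending into the half network picked
-- by each bit of m, and the two routes are closed by the clique edge between their copies of
-- that vertex.  The copies used by a route encode (source, m, q), so distinct triples give
-- disjoint routes, and ⌊t/s⌋ values of q are available for every pair (source, m).  Pairs are
-- linked greedily, each terminal consuming one route from its input: the two inputs of a new
-- pair have used at most 2⌊t/3⌋ < s⌊t/s⌋ routes, so some m still has room for both.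

module Submission where

open import Defs
open import Data.Nat using (ℕ; suc; _*_; _^_; _<_; _≤_; NonZero)
open import Data.Nat.DivMod using (_/_)
open import Data.Product using (∃-syntax)

open import Algebra.Properties.CommutativeSemigroup using (interchange; x∙yz≈y∙xz; xy∙z≈xz∙y)
open import Data.Bool using (Bool; true; false)
import Data.Bool.Properties as Bool
open import Data.Empty using (⊥-elim)
open import Data.Fin using (Fin; zero; suc; toℕ; combine; inject≤; fromℕ<)
import Data.Fin.Properties as Fin
open import Data.List
  using (List; []; _∷_; [_]; _++_; map; concat; length; filter; reverse; take; allFin; cartesianProduct)
open import Data.List.Properties
  using (length-map; length-++; length-take; length-tabulate; unfold-reverse; filter-notAll)
open import Data.List.Membership.Propositional using (_∈_; _∉_)
open import Data.List.Membership.Propositional.Properties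
  using (∈-map⁻; ∈-++⁻; ∈-filter⁺; ∈-filter⁻; ∈-allFin)
open import Data.List.Relation.Binary.Disjoint.Propositional using (Disjoint)
open import Data.List.Relation.Binary.Equality.Propositional using (≋⇒≡)
open import Data.List.Relation.Binary.Pointwise using (Pointwise; []; _∷_)
import Data.List.Relation.Binary.Sublist.Propositional as Sublist
import Data.List.Relation.Binary.Sublist.Propositional.Properties as Sublist
open import Data.List.Relation.Unary.All using (All; []; _∷_)
open import Data.List.Relation.Unary.All.Properties using (All¬⇒¬Any; ¬Any⇒All¬)
open import Data.List.Relation.Unary.AllPairs using ([]; _∷_)
open import Data.List.Relation.Unary.Any using (here; there)
import Data.List.Relation.Unary.Any as Any
open import Data.List.Relation.Unary.Any.Properties using (reverse⁻)
open import Data.List.Relation.Unary.Unique.Propositional using (Unique)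
import Data.List.Relation.Unary.Unique.Propositional.Properties as Unique
open import Data.Nat using (zero; _+_; _⊓_; z≤n; s≤s; >-nonZero)
open import Data.Nat.DivMod using (_%_; m≡m%n+[m/n]*n; m%n<n; m/n*n≤m; m/n<m)
open import Data.Nat.Properties
import Data.Product as Product
open import Data.Product using (_×_; _,_; proj₁; proj₂)
import Data.Product.Properties as Product
open import Data.Sum using (_⊎_; inj₁; inj₂; [_,_]′)
open import Data.Vec using (Vec; []; _∷_)
import Data.Vec.Properties as Vec
open import Function using (_∘_; const)
open import Level using (0ℓ)
open import Relation.Binary.Definitions using (DecidableEquality)
open import Relation.Binary.PropositionalEquality
  using (_≡_; _≢_; _≗_; refl; sym; trans; cong; cong₂; subst; module ≡-Reasoning)
open import Relation.Nullary using (¬_; Dec; yes; no)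
open import Relation.Unary using (Pred; Decidable; _⊆_)

Bits : ℕ → Set
Bits = Vec Bool

bit : Bool → Fin 2
bit false = zero
bit true  = suc zero

bit-injective : ∀ {b c} → bit b ≡ bit c → b ≡ c
bit-injective {false} {false} _ = refl
bit-injective {true}  {true}  _ = refl
bit-injective {false} {true}  ()
bit-injective {true}  {false} ()

toFin : ∀ {k} → Bits k → Fin (2 ^ k)
toFin []      = zero
toFin (b ∷ v) = combine (bit b) (toFin v)

toFin-injective : ∀ {k} {v w : Bits k} → toFin v ≡ toFin w → v ≡ w
toFin-injective {v = []}    {[]}    _ = refl
toFin-injective {v = b ∷ v} {c ∷ w} eq =
  let b≡c , v≡w = Fin.combine-injective (bit b) (toFin v) (bit c) (toFin w) eq
  in cong₂ _∷_ (bit-injective b≡c) (toFin-injective v≡w)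

toFin-∷-Half : ∀ {k} b (v : Bits k) → Half (2 ^ k) (toℕ (toFin (b ∷ v))) (toℕ (toFin v))
toFin-∷-Half {k} false v = inj₁ (begin
  toℕ (toFin (false ∷ v))      ≡⟨ Fin.toℕ-combine (bit false) (toFin v) ⟩
  2 ^ k * 0 + toℕ (toFin v)    ≡⟨ cong (_+ toℕ (toFin v)) (*-zeroʳ (2 ^ k)) ⟩
  toℕ (toFin v)                ∎)
  where open ≡-Reasoning
toFin-∷-Half {k} true v = inj₂ (begin
  toℕ (toFin (true ∷ v))       ≡⟨ Fin.toℕ-combine (bit true) (toFin v) ⟩
  2 ^ k * 1 + toℕ (toFin v)    ≡⟨ cong (_+ toℕ (toFin v)) (*-identityʳ (2 ^ k)) ⟩
  2 ^ k + toℕ (toFin v)        ≡⟨ +-comm (2 ^ k) (toℕ (toFin v)) ⟩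
  toℕ (toFin v) + 2 ^ k        ∎)
  where open ≡-Reasoning

allBits : ∀ k → List (Bits k)
allBits zero    = [] ∷ []
allBits (suc k) = map (false ∷_) (allBits k) ++ map (true ∷_) (allBits k)

length-allBits : ∀ k → length (allBits k) ≡ 2 ^ k
length-allBits zero    = refl
length-allBits (suc k) = begin
  length (map (false ∷_) (allBits k) ++ map (true ∷_) (allBits k))
    ≡⟨ length-++ (map (false ∷_) (allBits k)) ⟩
  length (map (false ∷_) (allBits k)) + length (map (true ∷_) (allBits k))
    ≡⟨ cong₂ _+_ (length-map (false ∷_) (allBits k)) (length-map (true ∷_) (allBits k)) ⟩
  length (allBits k) + length (allBits k)
    ≡⟨ cong (λ l → l + l) (length-allBits k) ⟩
  2 ^ k + 2 ^ k
    ≡⟨ cong (2 ^ k +_) (sym (+-identityʳ (2 ^ k))) ⟩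
  2 ^ suc k ∎
  where open ≡-Reasoning

allBits-unique : ∀ k → Unique (allBits k)
allBits-unique zero    = [] ∷ []
allBits-unique (suc k) =
  Unique.++⁺ (Unique.map⁺ Vec.∷-injectiveʳ (allBits-unique k))
             (Unique.map⁺ Vec.∷-injectiveʳ (allBits-unique k))
             heads-differ
  where
  heads-differ : Disjoint (map (false ∷_) (allBits k)) (map (true ∷_) (allBits k))
  heads-differ (v∈ , w∈) with ∈-map⁻ (false ∷_) v∈ | ∈-map⁻ (true ∷_) w∈
  ... | _ , _ , refl | _ , _ , ()

sumBits : ∀ k → (Bits k → ℕ) → ℕ
sumBits zero    f = f []
sumBits (suc k) f = sumBits k (f ∘ (false ∷_)) + sumBits k (f ∘ (true ∷_))

sumBits-cong : ∀ k {f g : Bits k → ℕ} → f ≗ g → sumBits k f ≡ sumBits k g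
sumBits-cong zero    f≗g = f≗g []
sumBits-cong (suc k) f≗g =
  cong₂ _+_ (sumBits-cong k (f≗g ∘ (false ∷_))) (sumBits-cong k (f≗g ∘ (true ∷_)))

sumBits-zero : ∀ k → sumBits k (const 0) ≡ 0
sumBits-zero zero    = refl
sumBits-zero (suc k) = cong₂ _+_ (sumBits-zero k) (sumBits-zero k)

sumBits-+ : ∀ k (f g : Bits k → ℕ) → sumBits k (λ v → f v + g v) ≡ sumBits k f + sumBits k g
sumBits-+ zero    f g = refl
sumBits-+ (suc k) f g = begin
  sumBits k (λ v → f₀ v + g₀ v) + sumBits k (λ v → f₁ v + g₁ v)
    ≡⟨ cong₂ _+_ (sumBits-+ k f₀ g₀) (sumBits-+ k f₁ g₁) ⟩
  (sumBits k f₀ + sumBits k g₀) + (sumBits k f₁ + sumBits k g₁)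
    ≡⟨ interchange +-commutativeSemigroup (sumBits k f₀) (sumBits k g₀) (sumBits k f₁) (sumBits k g₁) ⟩
  (sumBits k f₀ + sumBits k f₁) + (sumBits k g₀ + sumBits k g₁) ∎
  where
  open ≡-Reasoning
  f₀ f₁ g₀ g₁ : Bits k → ℕ
  f₀ = f ∘ (false ∷_)
  f₁ = f ∘ (true ∷_)
  g₀ = g ∘ (false ∷_)
  g₁ = g ∘ (true ∷_)

sumBits-bump : ∀ k {f g : Bits k → ℕ} w → g w ≡ suc (f w) → (∀ v → v ≢ w → g v ≡ f v) →
               sumBits k g ≡ suc (sumBits k f)
sumBits-bump zero    []      at-w _     = at-w
sumBits-bump (suc k) (false ∷ w) at-w off-w =
  cong₂ _+_ (sumBits-bump k w at-w (λ v v≢w → off-w (false ∷ v) (v≢w ∘ Vec.∷-injectiveʳ)))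
            (sumBits-cong k (λ v → off-w (true ∷ v) (λ ())))
sumBits-bump (suc k) (true ∷ w) at-w off-w = trans
  (cong₂ _+_ (sumBits-cong k (λ v → off-w (false ∷ v) (λ ())))
             (sumBits-bump k w at-w (λ v v≢w → off-w (true ∷ v) (v≢w ∘ Vec.∷-injectiveʳ))))
  (+-suc _ _)

sumBits-< : ∀ k K (f : Bits k → ℕ) → sumBits k f < 2 ^ k * K → ∃[ v ] f v < K
sumBits-< zero    K f lt = [] , subst (f [] <_) (+-identityʳ K) lt
sumBits-< (suc k) K f lt with sumBits k (f ∘ (false ∷_)) <? 2 ^ k * K
... | yes lt₀ = let v , fv<K = sumBits-< k K (f ∘ (false ∷_)) lt₀ in false ∷ v , fv<K
... | no  ≮₀  = let v , fv<K = sumBits-< k K (f ∘ (true ∷_)) lt₁ in true ∷ v , fv<K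
  where
  lt₁ : sumBits k (f ∘ (true ∷_)) < 2 ^ k * K
  lt₁ = +-cancelˡ-< (2 ^ k * K) _ _ (begin-strict
    2 ^ k * K + sumBits k (f ∘ (true ∷_))  ≤⟨ +-monoˡ-≤ _ (≮⇒≥ ≮₀) ⟩
    sumBits (suc k) f                      <⟨ lt ⟩
    2 * 2 ^ k * K                          ≡⟨ *-assoc 2 (2 ^ k) K ⟩
    2 * (2 ^ k * K)                        ≡⟨ cong (2 ^ k * K +_) (+-identityʳ (2 ^ k * K)) ⟩
    2 ^ k * K + 2 ^ k * K                  ∎)
    where open ≤-Reasoning

module Increment {A : Set} (_≟_ : DecidableEquality A) where

  increment : (A → ℕ) → A → A → ℕ
  increment f a x with x ≟ a
  ... | yes _ = suc (f x)
  ... | no  _ = f x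

  increment-self : ∀ f a → increment f a a ≡ suc (f a)
  increment-self f a with a ≟ a
  ... | yes _   = refl
  ... | no  a≢a = ⊥-elim (a≢a refl)

  increment-other : ∀ f {a x} → x ≢ a → increment f a x ≡ f x
  increment-other f {a} {x} x≢a with x ≟ a
  ... | yes x≡a = ⊥-elim (x≢a x≡a)
  ... | no  _   = refl

  increment-≥ : ∀ f a x → f x ≤ increment f a x
  increment-≥ f a x with x ≟ a
  ... | yes _ = n≤1+n (f x)
  ... | no  _ = ≤-refl

module _ {A : Set} {P Q : Pred A 0ℓ} (P? : Decidable P) (Q? : Decidable Q) (P⊆Q : P ⊆ Q) where

  filter-⊆ : ∀ xs → filter P? xs Sublist.⊆ filter Q? xs
  filter-⊆ xs = Sublist.filter⁺ P? Q? (λ { refl → P⊆Q }) (Sublist.⊆-refl {x = xs})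

  length-filter-mono : ∀ xs → length (filter P? xs) ≤ length (filter Q? xs)
  length-filter-mono xs = Sublist.length-mono-≤ (filter-⊆ xs)

  -- Nested filters of equal length coincide, and x survives only the outer one.
  length-filter-< : ∀ {x xs} → x ∈ xs → Q x → ¬ P x → length (filter P? xs) < length (filter Q? xs)
  length-filter-< {x} {xs} x∈xs Qx ¬Px = ≤∧≢⇒< (length-filter-mono xs) λ same-length →
    let filters-equal = ≋⇒≡ (Sublist.to-≋ same-length (filter-⊆ xs))
    in ¬Px (proj₂ (∈-filter⁻ P? {xs = xs} (subst (x ∈_) (sym filters-equal) (∈-filter⁺ Q? x∈xs Qx))))

Unique-reverse : ∀ {A : Set} {xs : List A} → Unique xs → Unique (reverse xs)
Unique-reverse [] = []
Unique-reverse {xs = x ∷ xs} (x∉xs ∷ u) = subst Unique (sym (unfold-reverse x xs))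
  (Unique.++⁺ (Unique-reverse u) ([] ∷ []) λ { (x∈ , here refl) → All¬⇒¬Any x∉xs (reverse⁻ x∈) })

length-cartesianProduct : ∀ {A B : Set} (xs : List A) (ys : List B) →
                          length (cartesianProduct xs ys) ≡ length xs * length ys
length-cartesianProduct []       ys = refl
length-cartesianProduct (x ∷ xs) ys = begin
  length (map (x ,_) ys ++ cartesianProduct xs ys)   ≡⟨ length-++ (map (x ,_) ys) ⟩
  length (map (x ,_) ys) + length (cartesianProduct xs ys)
    ≡⟨ cong₂ _+_ (length-map (x ,_) ys) (length-cartesianProduct xs ys) ⟩
  length ys + length xs * length ys                 ∎
  where open ≡-Reasoning

ends-map : ∀ {A B : Set} (f : A → B) (ps : List (A × A)) →
           ends (map (Product.map f f) ps) ≡ map f (ends ps)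
ends-map f []             = refl
ends-map f ((a , b) ∷ ps) = cong (λ es → f a ∷ f b ∷ es) (ends-map f ps)

ends-∈-map⁻ : ∀ {A B : Set} (f : A → B) {xs : List A} (M : List (B × B)) →
              All (_∈ map f xs) (ends M) → ∃[ ps ] M ≡ map (Product.map f f) ps
ends-∈-map⁻ f []            []              = [] , refl
ends-∈-map⁻ f ((a , b) ∷ M) (a∈ ∷ b∈ ∷ M∈) with ∈-map⁻ f a∈ | ∈-map⁻ f b∈ | ends-∈-map⁻ f M M∈
... | x , _ , refl | y , _ , refl | ps , refl = (x , y) ∷ ps , refl

module _ {G : Graph} where

  walk-++ : ∀ {a b c d xs ys} → Walk G a b xs → Adj G b c → Walk G c d ys → Walk G a d (xs ++ ys)
  walk-++ here       b~c w = step b~c w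
  walk-++ (step e u) b~c w = step e (walk-++ u b~c w)

  walk-reverse : (∀ {x y} → Adj G x y → Adj G y x) → ∀ {a b xs} → Walk G a b xs → Walk G b a (reverse xs)
  walk-reverse sym-adj here = here
  walk-reverse sym-adj {a} (step {vs = vs} e w) =
    subst (Walk G _ a) (sym (unfold-reverse a vs)) (walk-++ (walk-reverse sym-adj w) (sym-adj e) here)

walk-map : ∀ {G H : Graph} (f : V G → V H) → (∀ {x y} → Adj G x y → Adj H (f x) (f y)) →
           ∀ {a b xs} → Walk G a b xs → Walk H (f a) (f b) (map f xs)
walk-map f f-adj here       = here
walk-map f f-adj (step e w) = step (f-adj e) (walk-map f f-adj w)

side : ∀ {n} → Bool → BV n → BV (suc n)
side false = up
side true  = down

side-injective : ∀ {n} {b c} {x y : BV n} → side b x ≡ side c y → b ≡ c × x ≡ y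
side-injective {b = false} {false} refl = refl , refl
side-injective {b = true}  {true}  refl = refl , refl
side-injective {b = false} {true}  ()
side-injective {b = true}  {false} ()

lift-side : ∀ {n} b {x y : BV n} → BE n x y → BE (suc n) (side b x) (side b y)
lift-side false = lift-up
lift-side true  = lift-down

inp-injective : ∀ {n} {i j : Fin (2 ^ suc n)} → inp {n} i ≡ inp j → i ≡ j
inp-injective refl = refl

out-injective : ∀ {n} {i j : Fin (2 ^ suc n)} → out {n} i ≡ out j → i ≡ j
out-injective refl = refl

data IsInput {n} : BV n → Set where
  input : ∀ i → IsInput (inp i)

side-¬IsInput : ∀ {n} b {x : BV n} → ¬ IsInput (side b x)
side-¬IsInput false ()
side-¬IsInput true  ()

Label : ℕ → Set → Set
Label n Q = Bits (suc n) × Q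

Labelled : ℕ → Set → Graph
Labelled n L .V = BV n × L
Labelled n L .Adj a b = BE n (proj₁ a) (proj₁ b)

middle : ∀ {n} → Bits (suc n) → BV n
middle {zero}  m       = out (toFin m)
middle {suc n} (c ∷ m) = side c (middle m)

pushLabel : ∀ {n Q} → Label n (Bool × Q) → Label (suc n) Q
pushLabel (w , b , q) = b ∷ w , q

liftCell : ∀ {n Q} → Bool → BV n × Label n (Bool × Q) → BV (suc n) × Label (suc n) Q
liftCell c = Product.map (side c) pushLabel

liftCell-injective : ∀ {n Q} {c c'} {y y' : BV n × Label n (Bool × Q)} →
                     liftCell c y ≡ liftCell c' y' → c ≡ c' × y ≡ y'
liftCell-injective {c = false} {false} refl = refl , refl
liftCell-injective {c = true}  {true}  refl = refl , refl
liftCell-injective {c = false} {true}  ()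
liftCell-injective {c = true}  {false} ()

-- After reading j bits of m, the route from v sits at a vertex determined by those bits and
-- the last ℓ - j bits of v; its label keeps the first j bits of v and the rest of m.  Hence a
-- cell determines (v , m , q).
routeStart : ∀ {n Q} → Bits (suc n) → Bits (suc n) → Q → BV n × Label n Q
routeStart {zero}  v       m       q = middle m , v , q
routeStart {suc n} (b ∷ v) (c ∷ m) q = side c (inp (toFin v)) , b ∷ m , q

route : ∀ {n Q} → Bits (suc n) → Bits (suc n) → Q → List (BV n × Label n Q)
route {zero}  v       m       q = [ routeStart v m q ]
route {suc n} (b ∷ v) (c ∷ m) q = routeStart (b ∷ v) (c ∷ m) q ∷ map (liftCell c) (route v m (b , q))

routeStart-edge : ∀ {n Q} (v m : Bits (suc n)) (q : Q) → BE n (inp (toFin v)) (proj₁ (routeStart v m q))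
routeStart-edge {zero}  v       m           q = base (toFin v) (toFin m)
routeStart-edge {suc n} (b ∷ v) (false ∷ m) q = in-up (toFin (b ∷ v)) (toFin v) (toFin-∷-Half b v)
routeStart-edge {suc n} (b ∷ v) (true ∷ m)  q = in-down (toFin (b ∷ v)) (toFin v) (toFin-∷-Half b v)

route-walk : ∀ {n Q} (v m : Bits (suc n)) (q : Q) →
             Walk (Labelled n (Label n Q)) (routeStart v m q) (middle m , v , q) (route v m q)
route-walk {zero}  v       m       q = here
route-walk {suc n} (b ∷ v) (c ∷ m) q =
  step (lift-side c (routeStart-edge v m (b , q)))
       (walk-map (liftCell c) (lift-side c) (route-walk v m (b , q)))

route-avoids-inputs : ∀ {n Q} {v m : Bits (suc n)} {q : Q} {x} → x ∈ route v m q → ¬ IsInput (proj₁ x)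
route-avoids-inputs {zero}                    (here refl) ()
route-avoids-inputs {suc n} {v = _ ∷ _} {c ∷ _} (here refl) = side-¬IsInput c
route-avoids-inputs {suc n} {v = _ ∷ _} {c ∷ _} (there x∈) with ∈-map⁻ (liftCell c) x∈
... | _ , _ , refl = side-¬IsInput c

-- The start cell sits on an input of a half network, no later cell does.
start-∉-lifted : ∀ {n Q} {b} c (v : Bits (suc n)) {m} {q : Q} {c' v' m' q'} →
                 routeStart (b ∷ v) (c ∷ m) q ∉ map (liftCell c') (route v' m' q')
start-∉-lifted c v {c' = c'} x∈ with ∈-map⁻ (liftCell c') x∈
... | y , y∈ , eq = route-avoids-inputs y∈ (subst IsInput (proj₂ (side-injective (cong proj₁ eq))) (input _))

route-unique : ∀ {n Q} (v m : Bits (suc n)) (q : Q) → Unique (route v m q)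
route-unique {zero}  v       m       q = [] ∷ []
route-unique {suc n} (b ∷ v) (c ∷ m) q =
  ¬Any⇒All¬ _ (start-∉-lifted c v) ∷ Unique.map⁺ (proj₂ ∘ liftCell-injective) (route-unique v m (b , q))

route-injective : ∀ {n Q} {v m v' m' : Bits (suc n)} {q q' : Q} {x} →
                  x ∈ route v m q → x ∈ route v' m' q' → (v , m , q) ≡ (v' , m' , q')
route-injective {zero} {m = m} {m' = m'} (here refl) (here eq)
  with cong proj₂ eq | toFin-injective {v = m} {m'} (out-injective (cong proj₁ eq))
... | refl | refl = refl
route-injective {suc n} {v = _ ∷ v} {_ ∷ _} {_ ∷ v'} {_ ∷ _} (here refl) (here eq)
  with side-injective (cong proj₁ eq) | cong proj₂ eq
... | refl , inp≡ | refl with toFin-injective {v = v} {v'} (inp-injective inp≡)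
... | refl = refl
route-injective {suc n} {v = _ ∷ v} {c ∷ _} {_ ∷ _} {_ ∷ _} (here refl) (there x∈') =
  ⊥-elim (start-∉-lifted c v x∈')
route-injective {suc n} {v = _ ∷ _} {_ ∷ _} {_ ∷ v'} {c' ∷ _} (there x∈) (here refl) =
  ⊥-elim (start-∉-lifted c' v' x∈)
route-injective {suc n} {v = _ ∷ _} {c ∷ _} {_ ∷ _} {c' ∷ _} (there x∈) (there x∈')
  with ∈-map⁻ (liftCell c) x∈ | ∈-map⁻ (liftCell c') x∈'
... | y , y∈ , refl | y' , y'∈ , eq with liftCell-injective eq
... | refl , refl with route-injective y∈ y'∈
... | refl = refl

module Linkage (n t d K : ℕ) (d<t : suc d ≤ t) (sK≤t : 2 ^ suc n * K ≤ t) where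

  G : Graph
  G = Blowup (BenesCheck n) t

  Address : Set
  Address = Bits (suc n)

  _≟ᴬ_ : DecidableEquality Address
  _≟ᴬ_ = Vec.≡-dec Bool._≟_

  Key : Set
  Key = Address × Fin (suc d)

  _≟ᴷ_ : DecidableEquality Key
  _≟ᴷ_ = Product.≡-dec _≟ᴬ_ Fin._≟_

  terminal : Key → V G
  terminal (v , α) = inp (toFin v) , inject≤ α d<t

  terminals : Key × Key → V G × V G
  terminals = Product.map terminal terminal

  terminal-injective : ∀ {k k'} → terminal k ≡ terminal k' → k ≡ k'
  terminal-injective {v , α} {v' , α'} eq with toFin-injective {v = v} {v'} (inp-injective (cong proj₁ eq))
  ... | refl = cong (v ,_) (Fin.inject≤-injective d<t d<t α α' (cong proj₂ eq))

  copy : Address × Fin K → Fin t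
  copy (w , q) = inject≤ (combine (toFin w) q) sK≤t

  copy-injective : ∀ {c c'} → copy c ≡ copy c' → c ≡ c'
  copy-injective {w , q} {w' , q'} eq
    with Fin.combine-injective (toFin w) q (toFin w') q' (Fin.inject≤-injective sK≤t sK≤t _ _ eq)
  ... | w≡w' , refl with toFin-injective {v = w} {w'} w≡w'
  ... | refl = refl

  embed : BV n × Label n (Fin K) → V G
  embed = Product.map₂ copy

  embed-injective : ∀ {x y} → embed x ≡ embed y → x ≡ y
  embed-injective {x , c} {y , c'} eq with cong proj₁ eq | copy-injective {c} {c'} (cong proj₂ eq)
  ... | refl | refl = refl

  network-edge : ∀ {x y : BV n} {i j} → BE n x y → Adj G (x , i) (y , j)
  network-edge e = inj₁ (inj₁ e)

  Adj-sym : ∀ {x y} → Adj G x y → Adj G y x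
  Adj-sym (inj₁ (inj₁ e))               = inj₁ (inj₂ (inj₁ e))
  Adj-sym (inj₁ (inj₂ (inj₁ e)))        = inj₁ (inj₁ e)
  Adj-sym (inj₁ (inj₂ (inj₂ (inj₁ e)))) = inj₁ (inj₂ (inj₂ (inj₂ e)))
  Adj-sym (inj₁ (inj₂ (inj₂ (inj₂ e)))) = inj₁ (inj₂ (inj₂ (inj₁ e)))
  Adj-sym (inj₂ (refl , i≢j))           = inj₂ (refl , i≢j ∘ sym)

  embeddedRoute : Address → Address → Fin K → List (V G)
  embeddedRoute v m q = map embed (route v m q)

  terminal-∉-route : ∀ k {v m q} → terminal k ∉ embeddedRoute v m q
  terminal-∉-route _ x∈ with ∈-map⁻ embed x∈
  ... | y , y∈ , eq = route-avoids-inputs y∈ (subst IsInput (cong proj₁ eq) (input _))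

  embeddedRoute-injective : ∀ {v m q v' m' q' x} → x ∈ embeddedRoute v m q → x ∈ embeddedRoute v' m' q' →
                            (v , m , q) ≡ (v' , m' , q')
  embeddedRoute-injective x∈ x∈' with ∈-map⁻ embed x∈ | ∈-map⁻ embed x∈'
  ... | y , y∈ , refl | y' , y'∈ , eq with embed-injective {y} {y'} eq
  ... | refl = route-injective y∈ y'∈

  leg : Key → Address → Fin K → List (V G)
  leg k m q = terminal k ∷ embeddedRoute (proj₁ k) m q

  leg-walk : ∀ k m q → Walk G (terminal k) (middle m , copy (proj₁ k , q)) (leg k m q)
  leg-walk (v , _) m q =
    step (network-edge (routeStart-edge v m q)) (walk-map embed network-edge (route-walk v m q))

  leg-unique : ∀ k m q → Unique (leg k m q)
  leg-unique (v , _) m q =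
    ¬Any⇒All¬ _ (terminal-∉-route (v , _)) ∷ Unique.map⁺ embed-injective (route-unique v m q)

  legs-disjoint : ∀ {ka kb m qa m' qb} → proj₁ ka ≢ proj₁ kb → Disjoint (leg ka m qa) (leg kb m' qb)
  legs-disjoint va≢vb (here refl  , here eq)   = va≢vb (cong proj₁ (terminal-injective eq))
  legs-disjoint {ka} va≢vb (here refl  , there x∈)  = terminal-∉-route ka x∈
  legs-disjoint {kb = kb} va≢vb (there x∈   , here refl) = terminal-∉-route kb x∈
  legs-disjoint va≢vb (there x∈   , there x∈') = va≢vb (cong proj₁ (embeddedRoute-injective x∈ x∈'))

  routedPath : Key → Key → Address → Fin K → Fin K → List (V G)
  routedPath ka kb m qa qb = leg ka m qa ++ reverse (leg kb m qb)

  ∈-routedPath⁻ : ∀ {ka kb m qa qb x} → x ∈ routedPath ka kb m qa qb → x ∈ leg ka m qa ⊎ x ∈ leg kb m qb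
  ∈-routedPath⁻ {ka} {m = m} {qa} x∈ with ∈-++⁻ (leg ka m qa) x∈
  ... | inj₁ x∈a = inj₁ x∈a
  ... | inj₂ x∈b = inj₂ (reverse⁻ x∈b)

  -- Distinct sources give distinct copies of the common middle vertex, which form a clique.
  routedPath-isPath : ∀ {ka kb} m qa qb → proj₁ ka ≢ proj₁ kb →
                      IsPath G (terminal ka) (terminal kb) (routedPath ka kb m qa qb)
  routedPath-isPath {ka} {kb} m qa qb va≢vb =
    walk-++ (leg-walk ka m qa) middle-edge (walk-reverse Adj-sym (leg-walk kb m qb)) ,
    Unique.++⁺ (leg-unique ka m qa) (Unique-reverse (leg-unique kb m qb))
      (λ (x∈a , x∈b) → legs-disjoint va≢vb (x∈a , reverse⁻ x∈b))
    where
    middle-edge : Adj G (middle m , copy (proj₁ ka , qa)) (middle m , copy (proj₁ kb , qb))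
    middle-edge = inj₂ (refl , va≢vb ∘ cong proj₁ ∘ copy-injective)

  directPath : Key → Key → List (V G)
  directPath ka kb = terminal ka ∷ terminal kb ∷ []

  directPath-isPath : ∀ {ka kb} → proj₁ ka ≡ proj₁ kb → ka ≢ kb →
                      IsPath G (terminal ka) (terminal kb) (directPath ka kb)
  directPath-isPath {va , α} {.va , β} refl ka≢kb =
    step (inj₂ (refl , ka≢kb ∘ cong (va ,_) ∘ Fin.inject≤-injective d<t d<t α β)) here ,
    ((ka≢kb ∘ terminal-injective) ∷ []) ∷ [] ∷ []

  Load : Set
  Load = Address × Address → ℕ

  -- The routes from v through m handed out so far are those with q < load (v , m).
  data Occupied (E : List Key) (load : Load) (x : V G) : Set where
    at-terminal : ∀ {k} → k ∈ E → x ≡ terminal k → Occupied E load x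
    on-route    : ∀ {v m q} → toℕ q < load (v , m) → x ∈ embeddedRoute v m q → Occupied E load x

  Occupied-mono : ∀ {E E' load load' x} → (∀ {k} → k ∈ E → k ∈ E') → (∀ p → load p ≤ load' p) →
                  Occupied E load x → Occupied E' load' x
  Occupied-mono E⊆E' _     (at-terminal k∈ refl) = at-terminal (E⊆E' k∈) refl
  Occupied-mono _    load≤ (on-route q< x∈)      = on-route (<-≤-trans q< (load≤ _)) x∈

  terminal-unoccupied : ∀ {E load k} → k ∉ E → ¬ Occupied E load (terminal k)
  terminal-unoccupied k∉E (at-terminal k'∈ eq) = k∉E (subst (_∈ _) (sym (terminal-injective eq)) k'∈)
  terminal-unoccupied {k = k} k∉E (on-route _ x∈) = terminal-∉-route k x∈

  leg-unoccupied : ∀ {E load k m q x} → k ∉ E → load (proj₁ k , m) ≤ toℕ q → x ∈ leg k m q →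
                   ¬ Occupied E load x
  leg-unoccupied k∉E _      (here refl) = terminal-unoccupied k∉E
  leg-unoccupied _   _      (there x∈)  (at-terminal {k'} _ refl) = terminal-∉-route k' x∈
  leg-unoccupied _   load≤q (there x∈)  (on-route q'<load x∈') with embeddedRoute-injective x∈ x∈'
  ... | refl = <⇒≱ q'<load load≤q

  leg-occupied : ∀ {E load k m q x} → k ∈ E → toℕ q < load (proj₁ k , m) → x ∈ leg k m q →
                 Occupied E load x
  leg-occupied k∈E _      (here refl) = at-terminal k∈E refl
  leg-occupied _   q<load (there x∈)  = on-route q<load x∈

  open import Data.List.Membership.DecPropositional _≟ᴷ_ using (_∈?_)

  demand : Address → List Key → ℕ
  demand v E = length (filter (λ α → (v , α) ∈? E) (allFin (suc d)))

  demand-mono : ∀ {v E E'} → (∀ {k} → k ∈ E → k ∈ E') → demand v E ≤ demand v E'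
  demand-mono {v} {E} {E'} E⊆E' =
    length-filter-mono (λ α → (v , α) ∈? E) (λ α → (v , α) ∈? E') E⊆E' (allFin (suc d))

  demand-< : ∀ {v α E} → (v , α) ∉ E → demand v E < demand v ((v , α) ∷ E)
  demand-< {v} {α} {E} k∉E =
    length-filter-< (λ β → (v , β) ∈? E) (λ β → (v , β) ∈? ((v , α) ∷ E)) there
                    (∈-allFin α) (here refl) k∉E

  demand-≤ : ∀ {v α E} → (v , α) ∉ E → demand v E ≤ d
  demand-≤ {v} {α} {E} k∉E = m<1+n⇒m≤n (subst (demand v E <_) (length-tabulate {n = suc d} (λ i → i))
    (filter-notAll (λ β → (v , β) ∈? E) (allFin (suc d)) (Any.map (λ { refl → k∉E }) (∈-allFin α))))

  open Increment (Product.≡-dec _≟ᴬ_ _≟ᴬ_)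

  rowSum : Load → Address → ℕ
  rowSum load v = sumBits (suc n) (λ m → load (v , m))

  -- Every processed terminal at input v has consumed at most one route from v.
  LoadBounded : List Key → Load → Set
  LoadBounded E load = ∀ v → rowSum load v ≤ demand v E

  LoadBounded-increment : ∀ {E load k} m → k ∉ E → LoadBounded E load →
                          LoadBounded (k ∷ E) (increment load (proj₁ k , m))
  LoadBounded-increment {E} {load} {v₀ , α} m k∉E bounded v = bound (v ≟ᴬ v₀)
    where
    open ≤-Reasoning
    bound : Dec (v ≡ v₀) → rowSum (increment load (v₀ , m)) v ≤ demand v ((v₀ , α) ∷ E)
    bound (yes refl) = begin
      rowSum (increment load (v , m)) v
        ≡⟨ sumBits-bump (suc n) m (increment-self load (v , m))
             (λ m' m'≢m → increment-other load {v , m} {v , m'} (m'≢m ∘ cong proj₂)) ⟩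
      suc (rowSum load v)               ≤⟨ s≤s (bounded v) ⟩
      suc (demand v E)                  ≤⟨ demand-< k∉E ⟩
      demand v ((v , α) ∷ E)            ∎
    bound (no v≢v₀) = begin
      rowSum (increment load (v₀ , m)) v
        ≡⟨ sumBits-cong (suc n) (λ m' → increment-other load {v₀ , m} {v , m'} (v≢v₀ ∘ cong proj₁)) ⟩
      rowSum load v                      ≤⟨ bounded v ⟩
      demand v E                         ≤⟨ demand-mono {v} there ⟩
      demand v ((v₀ , α) ∷ E)            ∎

  record Linked (M : List (Key × Key)) : Set where
    field
      paths    : List (List (V G))
      load     : Load
      linked   : Pointwise (λ ab → IsPath G (proj₁ ab) (proj₂ ab)) (map terminals M) paths
      disjoint : Unique (concat paths)
      occupied : ∀ {x} → x ∈ concat paths → Occupied (ends M) load x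
      bounded  : LoadBounded (ends M) load

  linked-[] : Linked []
  linked-[] = record
    { paths    = []
    ; load     = λ _ → 0
    ; linked   = []
    ; disjoint = []
    ; occupied = λ ()
    ; bounded  = λ v → subst (_≤ demand v []) (sym (sumBits-zero (suc n))) z≤n
    }

  link-direct : ∀ {ka kb M} → proj₁ ka ≡ proj₁ kb → Unique (ends ((ka , kb) ∷ M)) → Linked M →
                Linked ((ka , kb) ∷ M)
  link-direct {ka} {kb} {M} va≡vb ((ka≢kb ∷ ka∉E) ∷ kb∉E ∷ _) L = record
    { paths    = directPath ka kb ∷ paths
    ; load     = load
    ; linked   = direct ∷ linked
    ; disjoint = Unique.++⁺ (proj₂ direct) disjoint fresh
    ; occupied = occupied′
    ; bounded  = λ v → ≤-trans (bounded v) (demand-mono {v} (there ∘ there))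
    }
    where
    open Linked L
    direct : IsPath G (terminal ka) (terminal kb) (directPath ka kb)
    direct = directPath-isPath va≡vb ka≢kb
    fresh : Disjoint (directPath ka kb) (concat paths)
    fresh (here refl         , x∈) = terminal-unoccupied (All¬⇒¬Any ka∉E) (occupied x∈)
    fresh (there (here refl) , x∈) = terminal-unoccupied (All¬⇒¬Any kb∉E) (occupied x∈)
    occupied′ : ∀ {x} → x ∈ directPath ka kb ++ concat paths → Occupied (ka ∷ kb ∷ ends M) load x
    occupied′ x∈ with ∈-++⁻ (directPath ka kb) x∈
    ... | inj₁ (here refl)         = at-terminal (here refl) refl
    ... | inj₁ (there (here refl)) = at-terminal (there (here refl)) refl
    ... | inj₂ x∈old               = Occupied-mono (there ∘ there) (λ _ → ≤-refl) (occupied x∈old)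

  link-through : ∀ {ka kb M} (L : Linked M) m →
                 Linked.load L (proj₁ ka , m) + Linked.load L (proj₁ kb , m) < K →
                 proj₁ ka ≢ proj₁ kb → Unique (ends ((ka , kb) ∷ M)) → Linked ((ka , kb) ∷ M)
  link-through {ka@(va , _)} {kb@(vb , _)} {M} L m room va≢vb ((ka≢kb ∷ ka∉E) ∷ kb∉E ∷ _) = record
    { paths    = routedPath ka kb m qa qb ∷ paths
    ; load     = load″
    ; linked   = routed ∷ linked
    ; disjoint = Unique.++⁺ (proj₂ routed) disjoint fresh
    ; occupied = occupied′
    ; bounded  = LoadBounded-increment m (All¬⇒¬Any (ka≢kb ∷ ka∉E))
                   (LoadBounded-increment m (All¬⇒¬Any kb∉E) bounded)
    }
    where
    open Linked L
    open ≤-Reasoning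
    qa qb : Fin K
    qa = fromℕ< (≤-<-trans (m≤m+n _ _) room)
    qb = fromℕ< (≤-<-trans (m≤n+m _ _) room)
    load′ load″ : Load
    load′ = increment load (vb , m)
    load″ = increment load′ (va , m)
    routed : IsPath G (terminal ka) (terminal kb) (routedPath ka kb m qa qb)
    routed = routedPath-isPath m qa qb va≢vb
    load≤load″ : ∀ p → load p ≤ load″ p
    load≤load″ p = ≤-trans (increment-≥ load (vb , m) p) (increment-≥ load′ (va , m) p)
    qa<load″ : toℕ qa < load″ (va , m)
    qa<load″ = begin-strict
      toℕ qa               ≡⟨ Fin.toℕ-fromℕ< _ ⟩
      load (va , m)        ≤⟨ increment-≥ load (vb , m) (va , m) ⟩
      load′ (va , m)       <⟨ n<1+n _ ⟩
      suc (load′ (va , m)) ≡⟨ increment-self load′ (va , m) ⟨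
      load″ (va , m)       ∎
    qb<load″ : toℕ qb < load″ (vb , m)
    qb<load″ = begin-strict
      toℕ qb              ≡⟨ Fin.toℕ-fromℕ< _ ⟩
      load (vb , m)       <⟨ n<1+n _ ⟩
      suc (load (vb , m)) ≡⟨ increment-self load (vb , m) ⟨
      load′ (vb , m)      ≤⟨ increment-≥ load′ (va , m) (vb , m) ⟩
      load″ (vb , m)      ∎
    qa-unused : load (va , m) ≤ toℕ qa
    qa-unused = ≤-reflexive (sym (Fin.toℕ-fromℕ< _))
    qb-unused : load (vb , m) ≤ toℕ qb
    qb-unused = ≤-reflexive (sym (Fin.toℕ-fromℕ< _))
    fresh : Disjoint (routedPath ka kb m qa qb) (concat paths)
    fresh (x∈new , x∈old) =
      [ leg-unoccupied (All¬⇒¬Any ka∉E) qa-unused , leg-unoccupied (All¬⇒¬Any kb∉E) qb-unused ]′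
        (∈-routedPath⁻ {ka} {kb} x∈new) (occupied x∈old)
    occupied′ : ∀ {x} → x ∈ routedPath ka kb m qa qb ++ concat paths →
                Occupied (ka ∷ kb ∷ ends M) load″ x
    occupied′ x∈ =
      [ [ leg-occupied (here refl) qa<load″ , leg-occupied (there (here refl)) qb<load″ ]′
          ∘ ∈-routedPath⁻ {ka} {kb}
      , Occupied-mono (there ∘ there) load≤load″ ∘ occupied
      ]′ (∈-++⁻ (routedPath ka kb m qa qb) x∈)

  module Greedy (capacity : d + d < 2 ^ suc n * K) where

    free-middle : ∀ {E load ka kb} → ka ∉ E → kb ∉ E → LoadBounded E load →
                  ∃[ m ] load (proj₁ ka , m) + load (proj₁ kb , m) < K
    free-middle {E} {load} {va , _} {vb , _} ka∉E kb∉E bounded =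
      sumBits-< (suc n) K (λ m → load (va , m) + load (vb , m)) (begin-strict
        sumBits (suc n) (λ m → load (va , m) + load (vb , m))
          ≡⟨ sumBits-+ (suc n) (λ m → load (va , m)) (λ m → load (vb , m)) ⟩
        rowSum load va + rowSum load vb
          ≤⟨ +-mono-≤ (≤-trans (bounded va) (demand-≤ ka∉E)) (≤-trans (bounded vb) (demand-≤ kb∉E)) ⟩
        d + d
          <⟨ capacity ⟩
        2 ^ suc n * K ∎)
      where open ≤-Reasoning

    link-routed : ∀ {ka kb M} → proj₁ ka ≢ proj₁ kb → Unique (ends ((ka , kb) ∷ M)) → Linked M →
                  Linked ((ka , kb) ∷ M)
    link-routed {ka} {kb} va≢vb u@((_ ∷ ka∉E) ∷ kb∉E ∷ _) L =
      let m , room = free-middle {load = Linked.load L} {ka} {kb}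
                       (All¬⇒¬Any ka∉E) (All¬⇒¬Any kb∉E) (Linked.bounded L)
      in link-through L m room va≢vb u

    link : ∀ M → Unique (ends M) → Linked M
    link []              _                = linked-[]
    link ((ka , kb) ∷ M) u@(_ ∷ _ ∷ u-M) with proj₁ ka ≟ᴬ proj₁ kb
    ... | yes va≡vb = link-direct va≡vb u (link M u-M)
    ... | no  va≢vb = link-routed va≢vb u (link M u-M)

    terminals-matchingLinked : ∀ ks → MatchingLinked G (map terminal ks)
    terminals-matchingLinked ks M (ends∈ , ends-unique) with ends-∈-map⁻ terminal M ends∈
    ... | KM , refl = paths , linked , disjoint
      where open Linked (link KM (Unique.map⁻ (subst Unique (ends-map terminal KM) ends-unique)))

    allKeys : List Key
    allKeys = cartesianProduct (allBits (suc n)) (allFin (suc d))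

    matchingLinkedSet : ∀ k → k ≤ 2 ^ suc n * suc d → HasMatchingLinkedSet G k
    matchingLinkedSet k k≤ =
      map terminal (take k allKeys) ,
      Unique.map⁺ terminal-injective
        (Unique.take⁺ k (Unique.cartesianProduct⁺ (allBits-unique (suc n)) (Unique.allFin⁺ (suc d)))) ,
      length-terminals ,
      terminals-matchingLinked (take k allKeys)
      where
      open ≡-Reasoning
      length-terminals : length (map terminal (take k allKeys)) ≡ k
      length-terminals = begin
        length (map terminal (take k allKeys)) ≡⟨ length-map terminal (take k allKeys) ⟩
        length (take k allKeys)                ≡⟨ length-take k allKeys ⟩
        k ⊓ length allKeys
          ≡⟨ cong (k ⊓_) (length-cartesianProduct (allBits (suc n)) (allFin (suc d))) ⟩
        k ⊓ (length (allBits (suc n)) * length (allFin (suc d)))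
          ≡⟨ cong (k ⊓_) (cong₂ _*_ (length-allBits (suc n)) (length-tabulate (λ i → i))) ⟩
        k ⊓ (2 ^ suc n * suc d)                ≡⟨ m≤n⇒m⊓n≡m k≤ ⟩
        k                                      ∎

m<n*[1+m/n] : ∀ m n .{{_ : NonZero n}} → m < n * suc (m / n)
m<n*[1+m/n] m n = begin-strict
  m                 ≡⟨ m≡m%n+[m/n]*n m n ⟩
  m % n + m / n * n <⟨ +-monoˡ-< (m / n * n) (m%n<n m n) ⟩
  n + m / n * n     ≡⟨ cong (n +_) (*-comm (m / n) n) ⟩
  n + n * (m / n)   ≡⟨ *-suc n (m / n) ⟨
  n * suc (m / n)   ∎
  where open ≤-Reasoning

-- 2 t / 3 ≤ t - s < s ⌊t / s⌋ once t ≥ 3 s.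
double-third<quotient : ∀ s t .{{_ : NonZero s}} → 3 * s ≤ t → t / 3 + t / 3 < s * (t / s)
double-third<quotient s t 3s≤t = *-cancelˡ-< 3 _ _ (+-cancelˡ-< (3 * s) _ _ (begin-strict
  3 * s + 3 * (x + x)       ≡⟨ cong (3 * s +_) (*-distribˡ-+ 3 x x) ⟩
  3 * s + (3 * x + 3 * x)   ≤⟨ +-mono-≤ 3s≤t (+-mono-≤ 3x≤t 3x≤t) ⟩
  t + (t + t)               ≡⟨ cong (λ u → t + (t + u)) (+-identityʳ t) ⟨
  3 * t                     <⟨ *-monoʳ-< 3 (m<n*[1+m/n] t s) ⟩
  3 * (s * suc (t / s))     ≡⟨ cong (3 *_) (*-suc s (t / s)) ⟩
  3 * (s + s * (t / s))     ≡⟨ *-distribˡ-+ 3 s (s * (t / s)) ⟩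
  3 * s + 3 * (s * (t / s)) ∎))
  where
  open ≤-Reasoning
  x = t / 3
  3x≤t : 3 * x ≤ t
  3x≤t = subst (_≤ t) (*-comm x 3) (m/n*n≤m t 3)

quotient-bound : ∀ s t k → 3 * k < s * t → k < s * suc (t / 3)
quotient-bound s t k 3k<st = *-cancelˡ-< 3 k (s * suc (t / 3)) (begin-strict
  3 * k                 <⟨ 3k<st ⟩
  s * t                 ≤⟨ *-monoʳ-≤ s (<⇒≤ (m<n*[1+m/n] t 3)) ⟩
  s * (3 * suc (t / 3)) ≡⟨ x∙yz≈y∙xz *-commutativeSemigroup s 3 (suc (t / 3)) ⟩
  3 * (s * suc (t / 3)) ∎)
  where open ≤-Reasoning

floor-fraction< : ∀ s p q t .{{_ : NonZero q}} → 0 < t → 3 * p < s * q → 3 * ((p * t) / q) < s * t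
floor-fraction< s p q t 0<t 3p<sq = *-cancelʳ-< q (3 * ((p * t) / q)) (s * t) (begin-strict
  3 * ((p * t) / q) * q ≡⟨ *-assoc 3 ((p * t) / q) q ⟩
  3 * ((p * t) / q * q) ≤⟨ *-monoʳ-≤ 3 (m/n*n≤m (p * t) q) ⟩
  3 * (p * t)           ≡⟨ *-assoc 3 p t ⟨
  3 * p * t             <⟨ *-monoˡ-< t {{>-nonZero 0<t}} 3p<sq ⟩
  s * q * t             ≡⟨ xy∙z≈xz∙y *-commutativeSemigroup s q t ⟩
  s * t * q             ∎)
  where open ≤-Reasoning

3*2^[1+n]≤t⇒0<t : ∀ n {t} → 3 * 2 ^ suc n ≤ t → 0 < t
3*2^[1+n]≤t⇒0<t n = <-≤-trans (*-monoʳ-< 3 (m^n>0 2 (suc n)))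

blowup-matchingLinkedSet : ∀ n t k → 3 * 2 ^ suc n ≤ t → 3 * k < 2 ^ suc n * t →
                           HasMatchingLinkedSet (Blowup (BenesCheck n) t) k
blowup-matchingLinkedSet n t k 3s≤t 3k<st =
  Linkage.Greedy.matchingLinkedSet n t (t / 3) (t / s) d<t sK≤t (double-third<quotient s t 3s≤t)
    k (<⇒≤ (quotient-bound s t k 3k<st))
  where
  s : ℕ
  s = 2 ^ suc n
  instance
    s≢0 : NonZero s
    s≢0 = m^n≢0 2 (suc n)
    t≢0 : NonZero t
    t≢0 = >-nonZero (3*2^[1+n]≤t⇒0<t n 3s≤t)
  d<t : suc (t / 3) ≤ t
  d<t = m/n<m t 3 (s≤s (s≤s z≤n))
  sK≤t : s * (t / s) ≤ t
  sK≤t = subst (_≤ t) (*-comm (t / s) s) (m/n*n≤m t s)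

corollary24 : (n p q : ℕ) .{{_ : NonZero q}} → 0 < p → 3 * p < 2 ^ suc n * q →
    ∃[ T ] ((t : ℕ) → T ≤ t → HasMatchingLinkedSet (Blowup (BenesCheck n) t) ((p * t) / q))
corollary24 n p q _ 3p<sq = 3 * 2 ^ suc n , λ t 3s≤t →
  blowup-matchingLinkedSet n t ((p * t) / q) 3s≤t
    (floor-fraction< (2 ^ suc n) p q t (3*2^[1+n]≤t⇒0<t n 3s≤t) 3p<sq)
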